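{- Let $(X,\mathcal{R})$ be a set system with $|X|=n$, let $\delta_0\in(0,1]$ and $\lambda\in(0,1)$, and write $\mathcal{S}=\mathcal{R}^{\le\delta_0 n}$. \begin{enumerate} \item[(a)] If $\mathcal{M}$ is a $\lambda$-heavy $(1-\delta_0)$-Mnet for $(X,\mathcal{S}^{(c)})$, then $\mathcal{M}^{(c)}$ is a $(1-\lambda+\lambda\delta_0)$-container family for $(X,\mathcal{S})$. \item[(b)] If $\mathcal{C}$ is a $(1-\lambda)$-container family for $(X,\mathcal{S})$, then $\mathcal{C}^{(c)}$ is a $(\lambda-\delta_0)$-heavy $(1-\delta_0)$-Mnet for $(X,\mathcal{S}^{(c)})$. \end{enumerate}
   Context: For $\mathcal{R}\subseteq 2^X$: $\mathcal{R}^{\le t}=\{R\in\mathcal{R}:|R|\le t\}$, and for any family $\mathcal{F}$ of subsets of $X$, $\mathcal{F}^{(c)}=\{X\setminus F:F\in\mathcal{F}\}$. An $\varepsilon$-container family for $(X,\mathcal{F})$ is a collection $\mathcal{C}$ of subsets of $X$ such that for every $F\in\mathcal{F}$ there is $C\in\mathcal{C}$ with $F\subseteq C$ and $|C\setminus F|\le\varepsilon|X|$. A $\lambda$-heavy $\varepsilon$-Mnet for $(X,\mathcal{F})$ is a collection $\mathcal{M}$ of subsets of $X$ such that for every $F\in\mathcal{F}$ with $|F|\ge\varepsilon|X|$ there is $M\in\mathcal{M}$ with $M\subseteq F$ and $|M|\ge\lambda|F|$.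
   Formalization: The parameters $\delta_0\in(0,1]$ and $\lambda\in(0,1)$ are rational. -}

module Defs where

open import Data.Nat using (ℕ)
open import Data.Integer using (+_)
open import Data.Rational using (ℚ; _/_; _≤_; _*_)
open import Data.Fin.Subset using (Subset; ∁; _⊆_; _─_; ∣_∣)
open import Data.Product using (Σ; _×_)
open import Relation.Binary.PropositionalEquality using (_≡_)

-- Ground set X = Fin n; subsets of X are Subset n.
-- A family of subsets of X is a predicate on Subset n.
Family : ℕ → Set₁
Family n = Subset n → Set

⟦_⟧ : ℕ → ℚ
⟦ k ⟧ = (+ k) / 1

AtMost : ∀ {n} → ℚ → Family n → Family n
AtMost {n} δ 𝓡 R = 𝓡 R × (⟦ ∣ R ∣ ⟧ ≤ δ * ⟦ n ⟧)

Compl : ∀ {n} → Family n → Family n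
Compl 𝓕 S = Σ (Subset _) (λ F → 𝓕 F × (S ≡ ∁ F))

IsContainerFamily : ∀ {n} → ℚ → Family n → Family n → Set
IsContainerFamily {n} ε 𝓕 𝓒 =
  ∀ F → 𝓕 F → Σ (Subset n) (λ C → 𝓒 C × F ⊆ C × (⟦ ∣ C ─ F ∣ ⟧ ≤ ε * ⟦ n ⟧))

IsHeavyMnet : ∀ {n} → ℚ → ℚ → Family n → Family n → Set
IsHeavyMnet {n} lam ε 𝓕 𝓜 =
  ∀ F → 𝓕 F → ε * ⟦ n ⟧ ≤ ⟦ ∣ F ∣ ⟧ →
  Σ (Subset n) (λ M → 𝓜 M × M ⊆ F × (lam * ⟦ ∣ F ∣ ⟧ ≤ ⟦ ∣ M ∣ ⟧))

-- If |F| ≤ δ₀ n then |X ∖ F| ≥ (1 − δ₀) n, so the Mnet supplies M ⊆ X ∖ F with |M| ≥ λ |X ∖ F|; then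
-- X ∖ M ⊇ F, and (X ∖ M) ∖ F = (X ∖ F) ∖ M has at most (1 − λ) |X ∖ F| ≤ (1 − λ) n elements.
-- Conversely, a container C ⊇ F with |C ∖ F| ≤ (1 − λ) n gives X ∖ C ⊆ X ∖ F with
-- |X ∖ C| = n − |F| − |C ∖ F| ≥ (λ − δ₀) n ≥ (λ − δ₀) |X ∖ F| whenever λ ≥ δ₀ (and trivially otherwise).
module Submission where

open import Defs
open import Data.Nat using (ℕ)
open import Data.Rational using (ℚ; 0ℚ; 1ℚ; _≤_; _<_; _+_; _-_; _*_)
open import Data.Product using (_×_)

import Data.Nat as ℕ
import Data.Nat.Properties as ℕ
import Data.Integer as ℤ
import Data.Integer.Properties as ℤ
open import Data.Nat.Coprimality using (1-coprimeTo) renaming (sym to coprime-sym)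
open import Data.Rational using (mkℚ; -_; nonNegative; nonPositive)
open import Data.Rational.Properties
open import Data.Rational.Solver using (module +-*-Solver)
open import Data.Fin.Subset using (Subset; ∁; _⊆_; _─_; ∣_∣; inside; outside)
open import Data.Fin.Subset.Properties
  using (drop-∷-⊆; ∣p∣≤n; ∣∁p∣≡n∸∣p∣; p⊆q⇒∁p⊇∁q; x∈p⇒x∉∁p; x∉p⇒x∈∁p)
open import Data.Vec using (_∷_; []; here)
open import Data.Product using (_,_; proj₂)
open import Data.Sum using (inj₁; inj₂)
open import Function using (_∘_)
open import Relation.Binary.PropositionalEquality using (_≡_; refl; sym; trans; cong; cong₂)

open +-*-Solver using (solve; _:=_; con; _:+_; _:*_; _:-_)

private
  variable
    n : ℕ

∣∁p∣+∣p∣≡n : (p : Subset n) → ∣ ∁ p ∣ ℕ.+ ∣ p ∣ ≡ n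
∣∁p∣+∣p∣≡n p = trans (cong (ℕ._+ ∣ p ∣) (∣∁p∣≡n∸∣p∣ p)) (ℕ.m∸n+n≡m (∣p∣≤n p))

∣p─q∣+∣q∣≡∣p∣ : {p q : Subset n} → q ⊆ p → ∣ p ─ q ∣ ℕ.+ ∣ q ∣ ≡ ∣ p ∣
∣p─q∣+∣q∣≡∣p∣ {p = []}          {[]}          _   = refl
∣p─q∣+∣q∣≡∣p∣ {p = outside ∷ p} {outside ∷ q} q⊆p = ∣p─q∣+∣q∣≡∣p∣ (drop-∷-⊆ q⊆p)
∣p─q∣+∣q∣≡∣p∣ {p = inside  ∷ p} {outside ∷ q} q⊆p = cong ℕ.suc (∣p─q∣+∣q∣≡∣p∣ (drop-∷-⊆ q⊆p))
∣p─q∣+∣q∣≡∣p∣ {p = inside  ∷ p} {inside  ∷ q} q⊆p =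
  trans (ℕ.+-suc ∣ p ─ q ∣ ∣ q ∣) (cong ℕ.suc (∣p─q∣+∣q∣≡∣p∣ (drop-∷-⊆ q⊆p)))
∣p─q∣+∣q∣≡∣p∣ {p = outside ∷ p} {inside  ∷ q} q⊆p with () ← q⊆p here

∁p─q≡∁q─p : (p q : Subset n) → ∁ p ─ q ≡ ∁ q ─ p
∁p─q≡∁q─p []            []            = refl
∁p─q≡∁q─p (outside ∷ p) (outside ∷ q) = cong (inside  ∷_) (∁p─q≡∁q─p p q)
∁p─q≡∁q─p (outside ∷ p) (inside  ∷ q) = cong (outside ∷_) (∁p─q≡∁q─p p q)
∁p─q≡∁q─p (inside  ∷ p) (outside ∷ q) = cong (outside ∷_) (∁p─q≡∁q─p p q)
∁p─q≡∁q─p (inside  ∷ p) (inside  ∷ q) = cong (outside ∷_) (∁p─q≡∁q─p p q)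

q⊆∁p⇒p⊆∁q : {p q : Subset n} → q ⊆ ∁ p → p ⊆ ∁ q
q⊆∁p⇒p⊆∁q q⊆∁p x∈p = x∉p⇒x∈∁p (x∈p⇒x∉∁p x∈p ∘ q⊆∁p)

⟦k⟧≡mkℚ : ∀ k → ⟦ k ⟧ ≡ mkℚ (ℤ.+ k) 0 (coprime-sym (1-coprimeTo k))
⟦k⟧≡mkℚ k = normalize-coprime (coprime-sym (1-coprimeTo k))

⟦⟧-homo-+ : ∀ a b → ⟦ a ℕ.+ b ⟧ ≡ ⟦ a ⟧ + ⟦ b ⟧
⟦⟧-homo-+ a b rewrite ⟦k⟧≡mkℚ a | ⟦k⟧≡mkℚ b =
  /-cong (sym (cong₂ ℤ._+_ (ℤ.*-identityʳ (ℤ.+ a)) (ℤ.*-identityʳ (ℤ.+ b)))) refl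

⟦⟧-+-≡ : ∀ a b {c} → a ℕ.+ b ≡ c → ⟦ a ⟧ + ⟦ b ⟧ ≡ ⟦ c ⟧
⟦⟧-+-≡ a b a+b≡c = trans (sym (⟦⟧-homo-+ a b)) (cong ⟦_⟧ a+b≡c)

0≤⟦k⟧ : ∀ k → 0ℚ ≤ ⟦ k ⟧
0≤⟦k⟧ k = nonNegative⁻¹ ⟦ k ⟧ {{normalize-nonNeg k 1}}

p≤p+q : ∀ p {q} → 0ℚ ≤ q → p ≤ p + q
p≤p+q p {q} 0≤q = begin
  p       ≡⟨ +-identityʳ p ⟨
  p + 0ℚ  ≤⟨ +-monoʳ-≤ p 0≤q ⟩
  p + q   ∎
  where open ≤-Reasoning

⟦⟧-mono-≤ : ∀ {a b} → a ℕ.≤ b → ⟦ a ⟧ ≤ ⟦ b ⟧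
⟦⟧-mono-≤ {a} {b} a≤b = begin
  ⟦ a ⟧                 ≤⟨ p≤p+q ⟦ a ⟧ (0≤⟦k⟧ (b ℕ.∸ a)) ⟩
  ⟦ a ⟧ + ⟦ b ℕ.∸ a ⟧   ≡⟨ ⟦⟧-+-≡ a (b ℕ.∸ a) (ℕ.m+[n∸m]≡n a≤b) ⟩
  ⟦ b ⟧                 ∎
  where open ≤-Reasoning

p≤q⇒0≤q-p : ∀ {p q} → p ≤ q → 0ℚ ≤ q - p
p≤q⇒0≤q-p {p} {q} p≤q = begin
  0ℚ     ≡⟨ +-inverseʳ p ⟨
  p - p  ≤⟨ +-monoˡ-≤ (- p) p≤q ⟩
  q - p  ∎
  where open ≤-Reasoning

0≤p*q : ∀ {p q} → 0ℚ ≤ p → 0ℚ ≤ q → 0ℚ ≤ p * q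
0≤p*q {p} {q} 0≤p 0≤q =
  nonNegative⁻¹ _ {{nonNeg*nonNeg⇒nonNeg p {{nonNegative 0≤p}} q {{nonNegative 0≤q}}}}

p+q≡r⇒p≡r-q : ∀ {p q r} → p + q ≡ r → p ≡ r - q
p+q≡r⇒p≡r-q {p} {q} p+q≡r = trans
  (solve 2 (λ p q → p := (p :+ q) :- q) refl p q)
  (cong (_- q) p+q≡r)

c*x≤z⇒c*y≤z : ∀ c {x y z} → 0ℚ ≤ y → y ≤ x → 0ℚ ≤ z → c * x ≤ z → c * y ≤ z
c*x≤z⇒c*y≤z c {x} {y} {z} 0≤y y≤x 0≤z c*x≤z with ≤-total 0ℚ c
... | inj₁ 0≤c = ≤-trans (*-monoˡ-≤-nonNeg c {{nonNegative 0≤c}} y≤x) c*x≤z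
... | inj₂ c≤0 = ≤-trans
  (nonPositive⁻¹ _ {{nonPos*nonNeg⇒nonPos c {{nonPositive c≤0}} y {{nonNegative 0≤y}}}}) 0≤z

∣p∣≤δn⇒[1-δ]n≤∣∁p∣ : ∀ δ (p : Subset n) → ⟦ ∣ p ∣ ⟧ ≤ δ * ⟦ n ⟧ → (1ℚ - δ) * ⟦ n ⟧ ≤ ⟦ ∣ ∁ p ∣ ⟧
∣p∣≤δn⇒[1-δ]n≤∣∁p∣ {n} δ p ∣p∣≤δn = begin
  (1ℚ - δ) * ⟦ n ⟧     ≡⟨ solve 2 (λ δ N → (con 1ℚ :- δ) :* N := N :- δ :* N) refl δ ⟦ n ⟧ ⟩
  ⟦ n ⟧ - δ * ⟦ n ⟧    ≤⟨ +-monoʳ-≤ ⟦ n ⟧ (neg-antimono-≤ ∣p∣≤δn) ⟩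
  ⟦ n ⟧ - ⟦ ∣ p ∣ ⟧    ≡⟨ p+q≡r⇒p≡r-q (⟦⟧-+-≡ ∣ ∁ p ∣ ∣ p ∣ (∣∁p∣+∣p∣≡n p)) ⟨
  ⟦ ∣ ∁ p ∣ ⟧          ∎
  where open ≤-Reasoning

c∣p∣≤∣q∣⇒∣p─q∣≤[1-c]∣p∣ : ∀ c {p q : Subset n} → q ⊆ p →
  c * ⟦ ∣ p ∣ ⟧ ≤ ⟦ ∣ q ∣ ⟧ → ⟦ ∣ p ─ q ∣ ⟧ ≤ (1ℚ - c) * ⟦ ∣ p ∣ ⟧
c∣p∣≤∣q∣⇒∣p─q∣≤[1-c]∣p∣ c {p} {q} q⊆p c∣p∣≤∣q∣ = begin
  ⟦ ∣ p ─ q ∣ ⟧              ≡⟨ p+q≡r⇒p≡r-q (⟦⟧-+-≡ ∣ p ─ q ∣ ∣ q ∣ (∣p─q∣+∣q∣≡∣p∣ q⊆p)) ⟩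
  ⟦ ∣ p ∣ ⟧ - ⟦ ∣ q ∣ ⟧      ≤⟨ +-monoʳ-≤ ⟦ ∣ p ∣ ⟧ (neg-antimono-≤ c∣p∣≤∣q∣) ⟩
  ⟦ ∣ p ∣ ⟧ - c * ⟦ ∣ p ∣ ⟧  ≡⟨ solve 2 (λ c P → P :- c :* P := (con 1ℚ :- c) :* P) refl c ⟦ ∣ p ∣ ⟧ ⟩
  (1ℚ - c) * ⟦ ∣ p ∣ ⟧       ∎
  where open ≤-Reasoning

∣p∣≤δn⇒∣q─p∣≤[1-c]n⇒[c-δ]n≤∣∁q∣ : ∀ c δ {p q : Subset n} → p ⊆ q →
  ⟦ ∣ p ∣ ⟧ ≤ δ * ⟦ n ⟧ → ⟦ ∣ q ─ p ∣ ⟧ ≤ (1ℚ - c) * ⟦ n ⟧ → (c - δ) * ⟦ n ⟧ ≤ ⟦ ∣ ∁ q ∣ ⟧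
∣p∣≤δn⇒∣q─p∣≤[1-c]n⇒[c-δ]n≤∣∁q∣ {n} c δ {p} {q} p⊆q ∣p∣≤δn ∣q─p∣≤[1-c]n = begin
  (c - δ) * ⟦ n ⟧                                ≡⟨ solve 3 (λ c δ N →
       (c :- δ) :* N := N :- ((con 1ℚ :- c) :* N :+ δ :* N)) refl c δ ⟦ n ⟧ ⟩
  ⟦ n ⟧ - ((1ℚ - c) * ⟦ n ⟧ + δ * ⟦ n ⟧)          ≤⟨ +-monoʳ-≤ ⟦ n ⟧
       (neg-antimono-≤ (+-mono-≤ ∣q─p∣≤[1-c]n ∣p∣≤δn)) ⟩
  ⟦ n ⟧ - (⟦ ∣ q ─ p ∣ ⟧ + ⟦ ∣ p ∣ ⟧)             ≡⟨ p+q≡r⇒p≡r-q n≡∁q+[q─p]+p ⟨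
  ⟦ ∣ ∁ q ∣ ⟧                                    ∎
  where
  open ≤-Reasoning
  n≡∁q+[q─p]+p : ⟦ ∣ ∁ q ∣ ⟧ + (⟦ ∣ q ─ p ∣ ⟧ + ⟦ ∣ p ∣ ⟧) ≡ ⟦ n ⟧
  n≡∁q+[q─p]+p = begin-equality
    ⟦ ∣ ∁ q ∣ ⟧ + (⟦ ∣ q ─ p ∣ ⟧ + ⟦ ∣ p ∣ ⟧)  ≡⟨ cong (⟦ ∣ ∁ q ∣ ⟧ +_) (⟦⟧-+-≡ ∣ q ─ p ∣ ∣ p ∣ (∣p─q∣+∣q∣≡∣p∣ p⊆q)) ⟩
    ⟦ ∣ ∁ q ∣ ⟧ + ⟦ ∣ q ∣ ⟧                     ≡⟨ ⟦⟧-+-≡ ∣ ∁ q ∣ ∣ q ∣ (∣∁p∣+∣p∣≡n q) ⟩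
    ⟦ n ⟧                                      ∎

SizeBoundedBy : ℚ → Family n → Set
SizeBoundedBy {n} δ 𝓕 = ∀ F → 𝓕 F → ⟦ ∣ F ∣ ⟧ ≤ δ * ⟦ n ⟧

AtMost-sizeBounded : ∀ δ (𝓡 : Family n) → SizeBoundedBy δ (AtMost δ 𝓡)
AtMost-sizeBounded δ 𝓡 F = proj₂

module _ {δ : ℚ} {𝓕 : Family n} (small : SizeBoundedBy δ 𝓕) where

  heavyMnet⇒containerFamily : ∀ c {𝓜 : Family n} → 0ℚ ≤ δ → 0ℚ ≤ c → c ≤ 1ℚ →
    IsHeavyMnet c (1ℚ - δ) (Compl 𝓕) 𝓜 → IsContainerFamily (1ℚ - c + c * δ) 𝓕 (Compl 𝓜)
  heavyMnet⇒containerFamily c 0≤δ 0≤c c≤1 mnet F F∈𝓕 =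
    let M , M∈𝓜 , M⊆∁F , heavy = mnet (∁ F) (F , F∈𝓕 , refl) (∣p∣≤δn⇒[1-δ]n≤∣∁p∣ δ F (small F F∈𝓕))
    in ∁ M , (M , M∈𝓜 , refl) , q⊆∁p⇒p⊆∁q M⊆∁F , slack M⊆∁F heavy
    where
    open ≤-Reasoning
    slack : ∀ {M} → M ⊆ ∁ F → c * ⟦ ∣ ∁ F ∣ ⟧ ≤ ⟦ ∣ M ∣ ⟧ → ⟦ ∣ ∁ M ─ F ∣ ⟧ ≤ (1ℚ - c + c * δ) * ⟦ n ⟧
    slack {M} M⊆∁F heavy = begin
      ⟦ ∣ ∁ M ─ F ∣ ⟧                    ≡⟨ cong (⟦_⟧ ∘ ∣_∣) (∁p─q≡∁q─p M F) ⟩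
      ⟦ ∣ ∁ F ─ M ∣ ⟧                    ≤⟨ c∣p∣≤∣q∣⇒∣p─q∣≤[1-c]∣p∣ c M⊆∁F heavy ⟩
      (1ℚ - c) * ⟦ ∣ ∁ F ∣ ⟧             ≤⟨ *-monoˡ-≤-nonNeg (1ℚ - c) {{nonNegative (p≤q⇒0≤q-p c≤1)}}
                                              (⟦⟧-mono-≤ (∣p∣≤n (∁ F))) ⟩
      (1ℚ - c) * ⟦ n ⟧                   ≤⟨ p≤p+q ((1ℚ - c) * ⟦ n ⟧) (0≤p*q (0≤p*q 0≤c 0≤δ) (0≤⟦k⟧ n)) ⟩
      (1ℚ - c) * ⟦ n ⟧ + c * δ * ⟦ n ⟧   ≡⟨ solve 3 (λ c δ N →
           (con 1ℚ :- c) :* N :+ c :* δ :* N := (con 1ℚ :- c :+ c :* δ) :* N) refl c δ ⟦ n ⟧ ⟩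
      (1ℚ - c + c * δ) * ⟦ n ⟧           ∎

  containerFamily⇒heavyMnet : ∀ c {𝓒 : Family n} →
    IsContainerFamily (1ℚ - c) 𝓕 𝓒 → IsHeavyMnet (c - δ) (1ℚ - δ) (Compl 𝓕) (Compl 𝓒)
  containerFamily⇒heavyMnet c containers .(∁ F) (F , F∈𝓕 , refl) _ =
    let C , C∈𝓒 , F⊆C , ∣C─F∣≤[1-c]n = containers F F∈𝓕
    in ∁ C , (C , C∈𝓒 , refl) , p⊆q⇒∁p⊇∁q F⊆C ,
       c*x≤z⇒c*y≤z (c - δ) (0≤⟦k⟧ ∣ ∁ F ∣) (⟦⟧-mono-≤ (∣p∣≤n (∁ F))) (0≤⟦k⟧ ∣ ∁ C ∣)
         (∣p∣≤δn⇒∣q─p∣≤[1-c]n⇒[c-δ]n≤∣∁q∣ c δ F⊆C (small F F∈𝓕) ∣C─F∣≤[1-c]n)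

lemma4p2 : (n : ℕ) (𝓡 : Family n) (δ₀ lam : ℚ) →
    0ℚ < δ₀ → δ₀ ≤ 1ℚ → 0ℚ < lam → lam < 1ℚ →
    ((𝓜 : Family n) →
      IsHeavyMnet lam (1ℚ - δ₀) (Compl (AtMost δ₀ 𝓡)) 𝓜 →
      IsContainerFamily (1ℚ - lam + lam * δ₀) (AtMost δ₀ 𝓡) (Compl 𝓜))
    ×
    ((𝓒 : Family n) →
      IsContainerFamily (1ℚ - lam) (AtMost δ₀ 𝓡) 𝓒 →
      IsHeavyMnet (lam - δ₀) (1ℚ - δ₀) (Compl (AtMost δ₀ 𝓡)) (Compl 𝓒))
lemma4p2 n 𝓡 δ₀ lam 0<δ₀ _ 0<lam lam<1 =
  (λ 𝓜 → heavyMnet⇒containerFamily small lam (<⇒≤ 0<δ₀) (<⇒≤ 0<lam) (<⇒≤ lam<1)) ,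
  (λ 𝓒 → containerFamily⇒heavyMnet small lam)
  where
  small : SizeBoundedBy δ₀ (AtMost δ₀ 𝓡)
  small = AtMost-sizeBounded δ₀ 𝓡
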